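{- Let $i,k,m,t$ be positive integers with $i\le k-2$ and $k\le m$. If $x_1,\dotsc,x_m$ are odd positive integers that are (in order) the denominators of the odd greedy expansion of $\sum_{j=1}^m1/x_j$, then \[ \frac{(x_i-2)x_{i}\cdots x_{k-1}}{2\sigma_{k-i-1}(x_i,\dotsc, x_{k-1})-x_i^2\sigma_{k-i-2}(x_{i+1},\dotsc,x_{k-1})} \] is greater than \[ \frac{(x_i-2)x_{i}\cdots x_{k-2}(x_{k-1}+2t)}{2\sigma_{k-i-1}(x_i,\dotsc, x_{k-2},x_{k-1}+2t)-x_i^2\sigma_{k-i-2}(x_{i+1},\dotsc, x_{k-2},x_{k-1}+2t)}. \]
   Context: $\sigma_k(y_1,\dots,y_r)$ denotes the elementary symmetric polynomial of degree $k$; $\sigma_0=1$, $\sigma_k=0$ for $k<0$. Odd greedy expansion: given a positive rational $q$, define $x_1,x_2,\dots$ recursively: writing $R_i=q-\sum_{j=1}^{i-1}1/x_j$, if $R_i\ge1$ let $x_i=1$, and if $0<R_i<1$ let $x_i$ be the unique odd positive integer with $\frac1{x_i}\le R_i<\frac1{x_i-2}$; stop when the remainder is $0$. The $x_i$ are the denominators. -}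

module Defs where

open import Data.Nat as ℕ using (ℕ; zero; suc; _≤_; _≡ᵇ_)
open import Data.Integer as ℤ using (ℤ; +_; -[1+_])
open import Data.Rational as ℚ using (ℚ; 0ℚ; 1ℚ)
open import Data.List using (List; []; _∷_; foldr)
open import Data.Product using (∃; _×_)
open import Data.Bool using (if_then_else_)
open import Relation.Binary.PropositionalEquality using (_≡_)

Odd : ℕ → Set
Odd n = ∃ λ j → n ≡ 2 ℕ.* j ℕ.+ 1

-- 1/n as a rational (only ever applied to positive n; 1/0 := 0)
inv : ℕ → ℚ
inv zero    = 0ℚ
inv (suc n) = (+ 1) ℚ./ suc n

sumInv : (ℕ → ℕ) → ℕ → ℚ
sumInv x zero    = 0ℚ
sumInv x (suc n) = sumInv x n ℚ.+ inv (x (suc n))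

-- x_1, …, x_m are (in order) the denominators of the odd greedy expansion
-- of q = Σ_{j=1}^m 1/x_j.  R_j = q - Σ_{l<j} 1/x_l.
IsOddGreedy : (ℕ → ℕ) → ℕ → Set
IsOddGreedy x m =
  (j : ℕ) → 1 ≤ j → j ≤ m →
    let R = sumInv x m ℚ.- sumInv x (j ℕ.∸ 1) in
    Odd (x j)
    × (1ℚ ℚ.≤ R → x j ≡ 1)
    × (R ℚ.< 1ℚ → (inv (x j) ℚ.≤ R × R ℚ.< inv (x j ℕ.∸ 2)))

σ : ℕ → List ℤ → ℤ
σ zero    ys       = + 1
σ (suc k) []       = + 0
σ (suc k) (y ∷ ys) = y ℤ.* σ k ys ℤ.+ σ (suc k) ys

prodℤ : List ℤ → ℤ
prodℤ = foldr ℤ._*_ (+ 1)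

slice : (ℕ → ℕ) → ℕ → ℕ → List ℤ
slice x a zero    = []
slice x a (suc n) = + x a ∷ slice x (suc a) n

-- total division of integers into ℚ (p/0 := 0; never used with 0 here)
frac : ℤ → ℤ → ℚ
frac p (+ zero)  = 0ℚ
frac p (+ suc n) = p ℚ./ suc n
frac p -[1+ n ]  = ℤ.- p ℚ./ suc n

expr : (ℕ → ℕ) → ℕ → ℕ → ℚ
expr x i k =
  frac ((+ x i ℤ.- + 2) ℤ.* prodℤ (slice x i (k ℕ.∸ i)))
       (+ 2 ℤ.* σ (k ℕ.∸ i ℕ.∸ 1) (slice x i (k ℕ.∸ i))
          ℤ.- (+ x i ℤ.* + x i) ℤ.* σ (k ℕ.∸ i ℕ.∸ 2) (slice x (suc i) (k ℕ.∸ i ℕ.∸ 1)))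

bump : (ℕ → ℕ) → ℕ → ℕ → (ℕ → ℕ)
bump x p d j = if j ≡ᵇ p then x j ℕ.+ d else x j

-- Put k = i + r + 2, a = x_i, A = a(a − 2), P = x_{i+1}⋯x_{k−2}, E = σ_{k−i−3}(x_{i+1},…,x_{k−2})
-- and Z = x_{k−1}.  Expanding σ along its last variable turns the expression into
--   A P Z / (2 P Z − A (P + Z E)),
-- and the cross difference of its values at Z and Z + d is (A P)² d > 0, so it strictly decreases
-- in Z as long as both denominators are positive.  The denominator is affine in Z with slope
-- 2P − A E.  If x_i = 1 then A = −1 and everything is manifestly positive.  If x_i ≥ 3, the greedy
-- choice of x_i gives 1/x_i + Σ_{j=i+1}^{k−1} 1/x_j ≤ R_i < 1/(x_i − 2), and as
-- Σ_{j=i+1}^{k−1} 1/x_j = (P + Z E)/(P Z) this is exactly the positivity of the denominator, which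
-- in turn forces a positive slope.

module Submission where

open import Defs
open import Data.Nat using (ℕ; _≤_; _∸_; _*_)
open import Data.Rational using (_<_)

open import Data.Bool using (true; false; T)
open import Data.Integer as ℤ using (ℤ; +_; +[1+_]; -[1+_]; +<+; +≤+; 0ℤ; -1ℤ)
import Data.Integer.Properties as ℤ
open import Data.Integer.Tactic.RingSolver using (solve-∀)
open import Data.List using (List; []; _∷_; _∷ʳ_; length)
open import Data.List.Relation.Unary.All using (All; []; _∷_)
open import Data.Nat as ℕ using (zero; suc; s≤s; z≤n)
import Data.Nat.Properties as ℕ
open import Data.Nat.Tactic.RingSolver using () renaming (solve-∀ to ℕ-solve-∀)
open import Data.Product using (_×_; _,_; ∃; proj₁; proj₂)
open import Data.Rational as ℚ using (ℚ)
import Data.Rational.Properties as ℚ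
open import Data.Rational.Unnormalised as ℚᵘ using (ℚᵘ; _/_; _≃_; *≡*; *≤*)
import Data.Rational.Unnormalised.Properties as ℚᵘ
open import Data.Rational.Unnormalised.Solver using (module +-*-Solver)
open import Data.Sum using (_⊎_; inj₁; inj₂)
open import Data.Unit using (tt)
open import Relation.Binary.PropositionalEquality
open import Relation.Nullary using (contradiction; yes; no)

*-pos : ∀ {i j} → 0ℤ ℤ.< i → 0ℤ ℤ.< j → 0ℤ ℤ.< i ℤ.* j
*-pos {+[1+ m ]} {+[1+ n ]} _         _         = +<+ (s≤s z≤n)
*-pos {+ zero}              (+<+ ()) _
*-pos {+[1+ m ]} {+ zero}   _         (+<+ ())

*-nonNeg : ∀ {i j} → 0ℤ ℤ.≤ i → 0ℤ ℤ.≤ j → 0ℤ ℤ.≤ i ℤ.* j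
*-nonNeg {+ m} {+ n} _ _ = subst (0ℤ ℤ.≤_) (ℤ.pos-* m n) (+≤+ z≤n)

square-pos : ∀ {i} → i ≢ 0ℤ → 0ℤ ℤ.< i ℤ.* i
square-pos {+ zero}    i≢0 = contradiction refl i≢0
square-pos {+[1+ n ]}  _   = +<+ (s≤s z≤n)
square-pos { -[1+ n ]} _   = +<+ (s≤s z≤n)

i<i+j : ∀ i {j} → 0ℤ ℤ.< j → i ℤ.< i ℤ.+ j
i<i+j i 0<j = subst (ℤ._< i ℤ.+ _) (ℤ.+-identityʳ i) (ℤ.+-monoʳ-< i 0<j)

i<j⇒0<j-i : ∀ {i j} → i ℤ.< j → 0ℤ ℤ.< j ℤ.- i
i<j⇒0<j-i {i} {j} i<j = subst (ℤ._< j ℤ.- i) (ℤ.+-inverseʳ i) (ℤ.+-monoˡ-< (ℤ.- i) i<j)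

frac-< : ∀ {n n′ d d′} → 0ℤ ℤ.< d → 0ℤ ℤ.< d′ → n′ ℤ.* d ℤ.< n ℤ.* d′ → frac n′ d′ < frac n d
frac-< {n} {n′} {+[1+ δ ]} {+[1+ δ′ ]} _ _ n′d<nd′ = ℚ.toℚᵘ-cancel-< (begin-strict
    ℚ.toℚᵘ (frac n′ +[1+ δ′ ]) ≃⟨ ℚ.toℚᵘ-fromℚᵘ (ℚᵘ.mkℚᵘ n′ δ′) ⟩
    ℚᵘ.mkℚᵘ n′ δ′              <⟨ ℚᵘ.*<* n′d<nd′ ⟩
    ℚᵘ.mkℚᵘ n δ                ≃⟨ ℚᵘ.≃-sym (ℚ.toℚᵘ-fromℚᵘ (ℚᵘ.mkℚᵘ n δ)) ⟩
    ℚ.toℚᵘ (frac n +[1+ δ ])   ∎)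
  where open ℚᵘ.≤-Reasoning
frac-< {d = + zero} (+<+ ())
frac-< {d = +[1+ _ ]} {+ zero} _ (+<+ ())

den : ℤ → ℤ → ℤ → ℤ → ℤ
den A P E Z = + 2 ℤ.* (P ℤ.* Z) ℤ.- A ℤ.* (P ℤ.+ Z ℤ.* E)

slope : ℤ → ℤ → ℤ → ℤ
slope A P E = + 2 ℤ.* P ℤ.- A ℤ.* E

ratio : ℤ → ℤ → ℤ → ℤ → ℚ
ratio A P E Z = frac (A ℤ.* (P ℤ.* Z)) (den A P E Z)

RatioConditions : ℤ → ℤ → ℤ → ℤ → Set
RatioConditions A P E Z = A ≢ 0ℤ × 0ℤ ℤ.< P × 0ℤ ℤ.< den A P E Z × 0ℤ ℤ.< slope A P E

ratio-decreasing : ∀ {A P E Z d} → RatioConditions A P E Z → 0ℤ ℤ.< d →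
  ratio A P E (Z ℤ.+ d) < ratio A P E Z
ratio-decreasing {A} {P} {E} {Z} {d} (A≢0 , 0<P , 0<den , 0<slope) 0<d = frac-< 0<den 0<den′ cross
  where
  N D : ℤ → ℤ
  N z = A ℤ.* (P ℤ.* z)
  D z = + 2 ℤ.* (P ℤ.* z) ℤ.- A ℤ.* (P ℤ.+ z ℤ.* E)
  -- solve-∀ does not unfold den and slope, so the ring identities here and below spell them out
  den-shift : ∀ A P E Z d →
    + 2 ℤ.* (P ℤ.* (Z ℤ.+ d)) ℤ.- A ℤ.* (P ℤ.+ (Z ℤ.+ d) ℤ.* E)
      ≡ + 2 ℤ.* (P ℤ.* Z) ℤ.- A ℤ.* (P ℤ.+ Z ℤ.* E) ℤ.+ d ℤ.* (+ 2 ℤ.* P ℤ.- A ℤ.* E)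
  den-shift = solve-∀
  cross-difference : ∀ A P E Z d →
    A ℤ.* (P ℤ.* Z) ℤ.* (+ 2 ℤ.* (P ℤ.* (Z ℤ.+ d)) ℤ.- A ℤ.* (P ℤ.+ (Z ℤ.+ d) ℤ.* E))
      ≡ A ℤ.* (P ℤ.* (Z ℤ.+ d)) ℤ.* (+ 2 ℤ.* (P ℤ.* Z) ℤ.- A ℤ.* (P ℤ.+ Z ℤ.* E))
          ℤ.+ A ℤ.* A ℤ.* (P ℤ.* P ℤ.* d)
  cross-difference = solve-∀
  0<den′ : 0ℤ ℤ.< den A P E (Z ℤ.+ d)
  0<den′ = subst (0ℤ ℤ.<_) (sym (den-shift A P E Z d)) (ℤ.+-mono-< 0<den (*-pos 0<d 0<slope))
  cross : N (Z ℤ.+ d) ℤ.* D Z ℤ.< N Z ℤ.* D (Z ℤ.+ d)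
  cross = subst (N (Z ℤ.+ d) ℤ.* D Z ℤ.<_) (sym (cross-difference A P E Z d))
                (i<i+j (N (Z ℤ.+ d) ℤ.* D Z) (*-pos (square-pos A≢0) (*-pos (*-pos 0<P 0<P) 0<d)))

conditions-at-−1 : ∀ {P E Z} → 0ℤ ℤ.< P → 0ℤ ℤ.≤ E → 0ℤ ℤ.≤ Z → RatioConditions -1ℤ P E Z
conditions-at-−1 {P} {E} {Z} 0<P 0≤E 0≤Z = (λ ()) , 0<P , 0<den , 0<slope
  where
  slope-identity : ∀ P E → + 2 ℤ.* P ℤ.- -1ℤ ℤ.* E ≡ + 2 ℤ.* P ℤ.+ E
  slope-identity = solve-∀
  den-identity : ∀ P E Z →
    + 2 ℤ.* (P ℤ.* Z) ℤ.- -1ℤ ℤ.* (P ℤ.+ Z ℤ.* E) ≡ Z ℤ.* (+ 2 ℤ.* P ℤ.- -1ℤ ℤ.* E) ℤ.+ P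
  den-identity = solve-∀
  0<slope : 0ℤ ℤ.< slope -1ℤ P E
  0<slope = subst (0ℤ ℤ.<_) (sym (slope-identity P E))
                  (ℤ.+-mono-<-≤ (*-pos {+ 2} (+<+ (s≤s z≤n)) 0<P) 0≤E)
  0<den : 0ℤ ℤ.< den -1ℤ P E Z
  0<den = subst (0ℤ ℤ.<_) (sym (den-identity P E Z))
                (ℤ.+-mono-≤-< (*-nonNeg 0≤Z (ℤ.<⇒≤ 0<slope)) 0<P)

slope-pos : ∀ {A P E Z} → 0ℤ ℤ.≤ A → 0ℤ ℤ.≤ P → 0ℤ ℤ.≤ Z → 0ℤ ℤ.< den A P E Z → 0ℤ ℤ.< slope A P E
slope-pos {A} {P} {E} {Z} 0≤A 0≤P 0≤Z 0<den = ℤ.*-cancelˡ-<-nonNeg Z {{ℤ.nonNegative 0≤Z}}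
  (subst₂ ℤ._<_ (sym (ℤ.*-zeroʳ Z)) (sym (identity A P E Z)) (ℤ.+-mono-<-≤ 0<den (*-nonNeg 0≤A 0≤P)))
  where
  identity : ∀ A P E Z →
    Z ℤ.* (+ 2 ℤ.* P ℤ.- A ℤ.* E) ≡ + 2 ℤ.* (P ℤ.* Z) ℤ.- A ℤ.* (P ℤ.+ Z ℤ.* E) ℤ.+ A ℤ.* P
  identity = solve-∀

σpred : ℕ → List ℤ → ℤ
σpred zero    ys = 0ℤ
σpred (suc k) ys = σ k ys

σ-∷ : ∀ k y ys → σ k (y ∷ ys) ≡ y ℤ.* σpred k ys ℤ.+ σ k ys
σ-∷ zero    y ys = sym (trans (cong (ℤ._+ + 1) (ℤ.*-zeroʳ y)) (ℤ.+-identityˡ (+ 1)))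
σ-∷ (suc k) y ys = refl

σ-∷ʳ : ∀ k ys z → σ k (ys ∷ʳ z) ≡ σ k ys ℤ.+ z ℤ.* σpred k ys
σ-∷ʳ zero    ys       z = sym (trans (cong (ℤ._+_ (+ 1)) (ℤ.*-zeroʳ z)) (ℤ.+-identityʳ (+ 1)))
σ-∷ʳ (suc k) []       z = ℤ.+-comm (z ℤ.* σ k []) 0ℤ
σ-∷ʳ (suc k) (y ∷ ys) z = begin
    y ℤ.* σ k (ys ∷ʳ z) ℤ.+ σ (suc k) (ys ∷ʳ z)
      ≡⟨ cong₂ (λ u v → y ℤ.* u ℤ.+ v) (σ-∷ʳ k ys z) (σ-∷ʳ (suc k) ys z) ⟩
    y ℤ.* (σ k ys ℤ.+ z ℤ.* σpred k ys) ℤ.+ (σ (suc k) ys ℤ.+ z ℤ.* σ k ys)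
      ≡⟨ identity y z (σpred k ys) (σ k ys) (σ (suc k) ys) ⟩
    y ℤ.* σ k ys ℤ.+ σ (suc k) ys ℤ.+ z ℤ.* (y ℤ.* σpred k ys ℤ.+ σ k ys)
      ≡⟨ cong (λ u → y ℤ.* σ k ys ℤ.+ σ (suc k) ys ℤ.+ z ℤ.* u) (sym (σ-∷ k y ys)) ⟩
    y ℤ.* σ k ys ℤ.+ σ (suc k) ys ℤ.+ z ℤ.* σ k (y ∷ ys) ∎
  where
  open ≡-Reasoning
  identity : ∀ y z s₀ s₁ s₂ →
    y ℤ.* (s₁ ℤ.+ z ℤ.* s₀) ℤ.+ (s₂ ℤ.+ z ℤ.* s₁) ≡ y ℤ.* s₁ ℤ.+ s₂ ℤ.+ z ℤ.* (y ℤ.* s₀ ℤ.+ s₁)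
  identity = solve-∀

σ-vanishes : ∀ {k} ys → length ys ℕ.< k → σ k ys ≡ 0ℤ
σ-vanishes {suc k} []       _          = refl
σ-vanishes {suc k} (y ∷ ys) (s≤s n<k)
  rewrite σ-vanishes ys n<k | σ-vanishes ys (ℕ.m<n⇒m<1+n n<k) =
  trans (ℤ.+-identityʳ (y ℤ.* 0ℤ)) (ℤ.*-zeroʳ y)

σ-length : ∀ ys → σ (length ys) ys ≡ prodℤ ys
σ-length []       = refl
σ-length (y ∷ ys) rewrite σ-length ys | σ-vanishes ys (ℕ.n<1+n (length ys)) =
  ℤ.+-identityʳ (y ℤ.* prodℤ ys)

prodℤ-∷ʳ : ∀ ys z → prodℤ (ys ∷ʳ z) ≡ prodℤ ys ℤ.* z
prodℤ-∷ʳ []       z = trans (ℤ.*-identityʳ z) (sym (ℤ.*-identityˡ z))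
prodℤ-∷ʳ (y ∷ ys) z = trans (cong (y ℤ.*_) (prodℤ-∷ʳ ys z)) (sym (ℤ.*-assoc y (prodℤ ys) z))

σpred-∷ : ∀ y ys → σpred (length (y ∷ ys)) (y ∷ ys) ≡ y ℤ.* σpred (length ys) ys ℤ.+ prodℤ ys
σpred-∷ y ys = trans (σ-∷ (length ys) y ys) (cong (ℤ._+_ (y ℤ.* σpred (length ys) ys)) (σ-length ys))

σ-nonNeg : ∀ k {ys} → All (0ℤ ℤ.≤_) ys → 0ℤ ℤ.≤ σ k ys
σ-nonNeg zero    _          = +≤+ z≤n
σ-nonNeg (suc k) []         = +≤+ z≤n
σ-nonNeg (suc k) (0≤y ∷ ps) = ℤ.+-mono-≤ (*-nonNeg 0≤y (σ-nonNeg k ps)) (σ-nonNeg (suc k) ps)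

σpred-nonNeg : ∀ k {ys} → All (0ℤ ℤ.≤_) ys → 0ℤ ℤ.≤ σpred k ys
σpred-nonNeg zero    _  = +≤+ z≤n
σpred-nonNeg (suc k) ps = σ-nonNeg k ps

prodℤ-pos : ∀ {ys} → All (0ℤ ℤ.<_) ys → 0ℤ ℤ.< prodℤ ys
prodℤ-pos []         = +<+ (s≤s z≤n)
prodℤ-pos (0<y ∷ ps) = *-pos 0<y (prodℤ-pos ps)

length-slice : ∀ f a n → length (slice f a n) ≡ n
length-slice f a zero    = refl
length-slice f a (suc n) = cong suc (length-slice f (suc a) n)

slice-suc : ∀ f a n → slice f a (suc n) ≡ slice f a n ∷ʳ + f (a ℕ.+ n)
slice-suc f a zero    rewrite ℕ.+-identityʳ a = refl
slice-suc f a (suc n) rewrite ℕ.+-suc a n     = cong (+ f a ∷_) (slice-suc f (suc a) n)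

σ-slice : ∀ f a n → σ n (slice f a n) ≡ prodℤ (slice f a n)
σ-slice f a n =
  subst (λ k → σ k (slice f a n) ≡ prodℤ (slice f a n)) (length-slice f a n) (σ-length (slice f a n))

σ-suc-slice : ∀ f a n → σ (suc n) (slice f a n) ≡ 0ℤ
σ-suc-slice f a n = σ-vanishes (slice f a n) (s≤s (ℕ.≤-reflexive (length-slice f a n)))

prodℤ-slice-suc : ∀ f a n → prodℤ (slice f a (suc n)) ≡ prodℤ (slice f a n) ℤ.* + f (a ℕ.+ n)
prodℤ-slice-suc f a n =
  trans (cong prodℤ (slice-suc f a n)) (prodℤ-∷ʳ (slice f a n) (+ f (a ℕ.+ n)))

σ-slice-suc : ∀ f a n →
  σ n (slice f a (suc n)) ≡ prodℤ (slice f a n) ℤ.+ + f (a ℕ.+ n) ℤ.* σpred n (slice f a n)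
σ-slice-suc f a n = begin
    σ n (slice f a (suc n))                              ≡⟨ cong (σ n) (slice-suc f a n) ⟩
    σ n (zs ∷ʳ Z)                                        ≡⟨ σ-∷ʳ n zs Z ⟩
    σ n zs ℤ.+ Z ℤ.* σpred n zs                          ≡⟨ cong (ℤ._+ Z ℤ.* σpred n zs) (σ-slice f a n) ⟩
    prodℤ zs ℤ.+ Z ℤ.* σpred n zs                        ∎
  where
  open ≡-Reasoning
  zs : List ℤ
  zs = slice f a n
  Z : ℤ
  Z = + f (a ℕ.+ n)

σ-suc-slice-suc : ∀ f a n → σ (suc n) (slice f a (suc n)) ≡ + f (a ℕ.+ n) ℤ.* prodℤ (slice f a n)
σ-suc-slice-suc f a n = begin
    σ (suc n) (slice f a (suc n))    ≡⟨ cong (σ (suc n)) (slice-suc f a n) ⟩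
    σ (suc n) (zs ∷ʳ Z)              ≡⟨ σ-∷ʳ (suc n) zs Z ⟩
    σ (suc n) zs ℤ.+ Z ℤ.* σ n zs    ≡⟨ cong₂ ℤ._+_ (σ-suc-slice f a n) (cong (Z ℤ.*_) (σ-slice f a n)) ⟩
    0ℤ ℤ.+ Z ℤ.* prodℤ zs            ≡⟨ ℤ.+-identityˡ (Z ℤ.* prodℤ zs) ⟩
    Z ℤ.* prodℤ zs                   ∎
  where
  open ≡-Reasoning
  zs : List ℤ
  zs = slice f a n
  Z : ℤ
  Z = + f (a ℕ.+ n)

All-slice : ∀ {Q : ℤ → Set} f a n → (∀ j → a ≤ j → j ℕ.< a ℕ.+ n → Q (+ f j)) → All Q (slice f a n)
All-slice f a zero    _ = []
All-slice f a (suc n) q = q a ℕ.≤-refl (ℕ.m<m+n a (s≤s z≤n)) ∷ All-slice f (suc a) n q′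
  where
  q′ : ∀ j → suc a ≤ j → j ℕ.< suc a ℕ.+ n → _
  q′ j a<j j<a+n = q j (ℕ.<⇒≤ a<j) (subst (j ℕ.<_) (sym (ℕ.+-suc a n)) j<a+n)

invᵘ : ℕ → ℚᵘ
invᵘ zero    = ℚᵘ.0ℚᵘ
invᵘ (suc n) = ℚᵘ.mkℚᵘ (+ 1) n

sumInvᵘ : List ℤ → ℚᵘ
sumInvᵘ []       = ℚᵘ.0ℚᵘ
sumInvᵘ (y ∷ ys) = invᵘ ℤ.∣ y ∣ ℚᵘ.+ sumInvᵘ ys

toℚᵘ-inv : ∀ n → ℚ.toℚᵘ (inv n) ≃ invᵘ n
toℚᵘ-inv zero    = ℚᵘ.≃-refl
toℚᵘ-inv (suc n) = ℚ.toℚᵘ-fromℚᵘ (ℚᵘ.mkℚᵘ (+ 1) n)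

toℚᵘ-sumInv-+ : ∀ x b n →
  ℚ.toℚᵘ (sumInv x (b ℕ.+ n)) ≃ ℚ.toℚᵘ (sumInv x b) ℚᵘ.+ sumInvᵘ (slice x (suc b) n)
toℚᵘ-sumInv-+ x b zero    rewrite ℕ.+-identityʳ b = ℚᵘ.≃-sym (ℚᵘ.+-identityʳ _)
toℚᵘ-sumInv-+ x b (suc n) rewrite ℕ.+-suc b n     = begin-equality
    ℚ.toℚᵘ (sumInv x (suc b ℕ.+ n))
      ≃⟨ toℚᵘ-sumInv-+ x (suc b) n ⟩
    ℚ.toℚᵘ (sumInv x b ℚ.+ inv (x (suc b))) ℚᵘ.+ S
      ≃⟨ ℚᵘ.+-congˡ S (ℚᵘ.≃-trans (ℚ.toℚᵘ-homo-+ (sumInv x b) (inv (x (suc b))))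
                                  (ℚᵘ.+-congʳ (ℚ.toℚᵘ (sumInv x b)) (toℚᵘ-inv (x (suc b))))) ⟩
    ℚ.toℚᵘ (sumInv x b) ℚᵘ.+ invᵘ (x (suc b)) ℚᵘ.+ S
      ≃⟨ ℚᵘ.+-assoc (ℚ.toℚᵘ (sumInv x b)) (invᵘ (x (suc b))) S ⟩
    ℚ.toℚᵘ (sumInv x b) ℚᵘ.+ (invᵘ (x (suc b)) ℚᵘ.+ S) ∎
  where
  open ℚᵘ.≤-Reasoning
  S : ℚᵘ
  S = sumInvᵘ (slice x (suc (suc b)) n)

toℚᵘ-remainder : ∀ x {b m} → b ≤ m →
  ℚ.toℚᵘ (sumInv x m ℚ.- sumInv x b) ≃ sumInvᵘ (slice x (suc b) (m ∸ b))
toℚᵘ-remainder x {b} {m} b≤m = begin-equality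
    ℚ.toℚᵘ (sumInv x m ℚ.- sumInv x b)
      ≃⟨ ℚᵘ.≃-trans (ℚ.toℚᵘ-homo-+ (sumInv x m) (ℚ.- sumInv x b))
                    (ℚᵘ.+-congʳ (ℚ.toℚᵘ (sumInv x m)) (ℚ.toℚᵘ-homo‿- (sumInv x b))) ⟩
    ℚ.toℚᵘ (sumInv x m) ℚᵘ.- B
      ≡⟨ cong (λ k → ℚ.toℚᵘ (sumInv x k) ℚᵘ.- B) (sym (ℕ.m+[n∸m]≡n b≤m)) ⟩
    ℚ.toℚᵘ (sumInv x (b ℕ.+ (m ∸ b))) ℚᵘ.- B
      ≃⟨ ℚᵘ.+-congˡ (ℚᵘ.- B) (toℚᵘ-sumInv-+ x b (m ∸ b)) ⟩
    B ℚᵘ.+ S ℚᵘ.- B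
      ≃⟨ solve 2 (λ B S → B :+ S :- B := S) ℚᵘ.≃-refl B S ⟩
    S ∎
  where
  open ℚᵘ.≤-Reasoning
  open +-*-Solver
  B S : ℚᵘ
  B = ℚ.toℚᵘ (sumInv x b)
  S = sumInvᵘ (slice x (suc b) (m ∸ b))

sumInvᵘ-nonNeg : ∀ ys → ℚᵘ.0ℚᵘ ℚᵘ.≤ sumInvᵘ ys
sumInvᵘ-nonNeg []       = ℚᵘ.≤-refl
sumInvᵘ-nonNeg (y ∷ ys) = ℚᵘ.+-mono-≤ (invᵘ-nonNeg ℤ.∣ y ∣) (sumInvᵘ-nonNeg ys)
  where
  invᵘ-nonNeg : ∀ n → ℚᵘ.0ℚᵘ ℚᵘ.≤ invᵘ n
  invᵘ-nonNeg zero    = ℚᵘ.≤-refl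
  invᵘ-nonNeg (suc n) = *≤* (+≤+ z≤n)

sumInvᵘ-slice-mono : ∀ f a {n n′} → n ≤ n′ → sumInvᵘ (slice f a n) ℚᵘ.≤ sumInvᵘ (slice f a n′)
sumInvᵘ-slice-mono f a {n′ = n′} z≤n = sumInvᵘ-nonNeg (slice f a n′)
sumInvᵘ-slice-mono f a (s≤s n≤n′)    = ℚᵘ.+-monoʳ-≤ (invᵘ (f a)) (sumInvᵘ-slice-mono f (suc a) n≤n′)

/1-+ : ∀ i j → (i ℤ.+ j) / 1 ≃ i / 1 ℚᵘ.+ j / 1
/1-+ i j = *≡* (identity i j)
  where
  identity : ∀ i j → (i ℤ.+ j) ℤ.* + 1 ≡ (i ℤ.* + 1 ℤ.+ j ℤ.* + 1) ℤ.* + 1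
  identity = solve-∀

/1-*-invᵘ : ∀ {y} → 0ℤ ℤ.< y → y / 1 ℚᵘ.* invᵘ ℤ.∣ y ∣ ≃ ℚᵘ.1ℚᵘ
/1-*-invᵘ {+[1+ n ]} _ = ℚᵘ.*-inverseʳ (+[1+ n ] / 1)
/1-*-invᵘ {+ zero} (+<+ ())

prodℤ-*-sumInvᵘ : ∀ {ys} → All (0ℤ ℤ.<_) ys →
  prodℤ ys / 1 ℚᵘ.* sumInvᵘ ys ≃ σpred (length ys) ys / 1
prodℤ-*-sumInvᵘ []                   = *≡* refl
prodℤ-*-sumInvᵘ {y ∷ ys} (0<y ∷ ps) = begin-equality
    (y / 1 ℚᵘ.* P) ℚᵘ.* (invᵘ ℤ.∣ y ∣ ℚᵘ.+ S)
      ≃⟨ solve 4 (λ y P i S → (y :* P) :* (i :+ S) := (y :* i) :* P :+ y :* (P :* S)) ℚᵘ.≃-refl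
               (y / 1) P (invᵘ ℤ.∣ y ∣) S ⟩
    (y / 1 ℚᵘ.* invᵘ ℤ.∣ y ∣) ℚᵘ.* P ℚᵘ.+ y / 1 ℚᵘ.* (P ℚᵘ.* S)
      ≃⟨ ℚᵘ.+-cong (ℚᵘ.*-congʳ (/1-*-invᵘ 0<y)) (ℚᵘ.*-congˡ (prodℤ-*-sumInvᵘ ps)) ⟩
    ℚᵘ.1ℚᵘ ℚᵘ.* P ℚᵘ.+ y / 1 ℚᵘ.* (σpred (length ys) ys / 1)
      ≃⟨ ℚᵘ.+-congˡ (y / 1 ℚᵘ.* (σpred (length ys) ys / 1)) (ℚᵘ.*-identityˡ P) ⟩
    P ℚᵘ.+ (y ℤ.* σpred (length ys) ys) / 1
      ≃⟨ ℚᵘ.≃-sym (/1-+ (prodℤ ys) (y ℤ.* σpred (length ys) ys)) ⟩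
    (prodℤ ys ℤ.+ y ℤ.* σpred (length ys) ys) / 1
      ≡⟨ cong (_/ 1) (trans (ℤ.+-comm (prodℤ ys) (y ℤ.* σpred (length ys) ys)) (sym (σpred-∷ y ys))) ⟩
    σpred (length (y ∷ ys)) (y ∷ ys) / 1 ∎
  where
  open ℚᵘ.≤-Reasoning
  open +-*-Solver
  P S : ℚᵘ
  P = prodℤ ys / 1
  S = sumInvᵘ ys

reciprocal-gap : ∀ α β {S W T} → 0ℤ ℤ.< W → W / 1 ℚᵘ.* S ≃ T / 1 →
  invᵘ (suc α) ℚᵘ.+ S ℚᵘ.< invᵘ (suc β) →
  (+ suc α ℤ.* + suc β) ℤ.* T ℤ.< (+ suc α ℤ.- + suc β) ℤ.* W
reciprocal-gap α β {S} {W} {T} 0<W WS≃T gap =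
  subst₂ ℤ._<_ (identityˡ a b W T) (identityʳ a b W T) (ℤ.+-monoʳ-< (ℤ.- (b ℤ.* W)) scaled)
  where
  open +-*-Solver
  a b : ℤ
  a = + suc α
  b = + suc β
  M : ℚᵘ
  M = (a ℤ.* b ℤ.* W) / 1
  lhs : (invᵘ (suc α) ℚᵘ.+ S) ℚᵘ.* M ≃ (b ℤ.* W ℤ.+ T ℤ.* (a ℤ.* b)) / 1
  lhs = begin-equality
      (invᵘ (suc α) ℚᵘ.+ S) ℚᵘ.* M
        ≃⟨ solve 5 (λ i S a b W → (i :+ S) :* ((a :* b) :* W)
                                  := (a :* i) :* (b :* W) :+ (W :* S) :* (a :* b))
                 ℚᵘ.≃-refl (invᵘ (suc α)) S (a / 1) (b / 1) (W / 1) ⟩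
      (a / 1 ℚᵘ.* invᵘ (suc α)) ℚᵘ.* ((b ℤ.* W) / 1) ℚᵘ.+ (W / 1 ℚᵘ.* S) ℚᵘ.* ((a ℤ.* b) / 1)
        ≃⟨ ℚᵘ.+-cong (ℚᵘ.≃-trans (ℚᵘ.*-congʳ (/1-*-invᵘ {a} (+<+ (s≤s z≤n))))
                                 (ℚᵘ.*-identityˡ ((b ℤ.* W) / 1)))
                     (ℚᵘ.*-congʳ WS≃T) ⟩
      (b ℤ.* W) / 1 ℚᵘ.+ (T ℤ.* (a ℤ.* b)) / 1
        ≃⟨ ℚᵘ.≃-sym (/1-+ (b ℤ.* W) (T ℤ.* (a ℤ.* b))) ⟩
      (b ℤ.* W ℤ.+ T ℤ.* (a ℤ.* b)) / 1 ∎
    where open ℚᵘ.≤-Reasoning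
  rhs : invᵘ (suc β) ℚᵘ.* M ≃ (a ℤ.* W) / 1
  rhs = begin-equality
      invᵘ (suc β) ℚᵘ.* M
        ≃⟨ solve 4 (λ i a b W → i :* ((a :* b) :* W) := (b :* i) :* (a :* W)) ℚᵘ.≃-refl
                 (invᵘ (suc β)) (a / 1) (b / 1) (W / 1) ⟩
      (b / 1 ℚᵘ.* invᵘ (suc β)) ℚᵘ.* ((a ℤ.* W) / 1)
        ≃⟨ ℚᵘ.≃-trans (ℚᵘ.*-congʳ (/1-*-invᵘ {b} (+<+ (s≤s z≤n)))) (ℚᵘ.*-identityˡ ((a ℤ.* W) / 1)) ⟩
      (a ℤ.* W) / 1 ∎
    where open ℚᵘ.≤-Reasoning
  0<abW : 0ℤ ℤ.< a ℤ.* b ℤ.* W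
  0<abW = *-pos (*-pos {a} {b} (+<+ (s≤s z≤n)) (+<+ (s≤s z≤n))) 0<W
  scaled : b ℤ.* W ℤ.+ T ℤ.* (a ℤ.* b) ℤ.< a ℤ.* W
  scaled = subst₂ ℤ._<_ (ℤ.*-identityʳ _) (ℤ.*-identityʳ _) (ℚᵘ.drop-*<*
    (ℚᵘ.<-respˡ-≃ lhs (ℚᵘ.<-respʳ-≃ rhs
      (ℚᵘ.*-monoˡ-<-pos M {{ℤ.positive 0<abW}} gap))))
  identityˡ : ∀ a b W T → ℤ.- (b ℤ.* W) ℤ.+ (b ℤ.* W ℤ.+ T ℤ.* (a ℤ.* b)) ≡ a ℤ.* b ℤ.* T
  identityˡ = solve-∀
  identityʳ : ∀ a b W T → ℤ.- (b ℤ.* W) ℤ.+ a ℤ.* W ≡ (a ℤ.- b) ℤ.* W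
  identityʳ = solve-∀

odd-positive : ∀ {n} → Odd n → 0 ℕ.< n
odd-positive {n} (j , n≡2j+1) = subst (0 ℕ.<_) (sym (trans n≡2j+1 (ℕ.+-comm (2 * j) 1))) (s≤s z≤n)

odd-cases : ∀ {n} → Odd n → n ≡ 1 ⊎ ∃ λ c → n ≡ suc (suc (suc c))
odd-cases (zero  , n≡1)      = inj₁ n≡1
odd-cases (suc j , n≡2j+3) = inj₂ (2 * j , trans n≡2j+3 (identity j))
  where
  identity : ∀ j → 2 * suc j ℕ.+ 1 ≡ suc (suc (suc (2 * j)))
  identity = ℕ-solve-∀

odd-greedy-gap : ∀ {x m i} n → IsOddGreedy x m → 1 ≤ i → i ℕ.+ n ≤ m → x i ≢ 1 →
  invᵘ (x i) ℚᵘ.+ sumInvᵘ (slice x (suc i) n) ℚᵘ.< invᵘ (x i ∸ 2)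
odd-greedy-gap {x} {m} {suc b} n greedy _ i+n≤m xᵢ≢1 = begin-strict
    sumInvᵘ (slice x (suc b) (suc n))      ≤⟨ sumInvᵘ-slice-mono x (suc b) 1+n≤m-b ⟩
    sumInvᵘ (slice x (suc b) (m ∸ b))      ≃⟨ ℚᵘ.≃-sym (toℚᵘ-remainder x b≤m) ⟩
    ℚ.toℚᵘ R                               <⟨ ℚ.toℚᵘ-mono-< (proj₂ (R<1⇒bounds R<1)) ⟩
    ℚ.toℚᵘ (inv (x (suc b) ∸ 2))           ≃⟨ toℚᵘ-inv (x (suc b) ∸ 2) ⟩
    invᵘ (x (suc b) ∸ 2)                   ∎
  where
  open ℚᵘ.≤-Reasoning
  i≤m : suc b ≤ m
  i≤m = ℕ.m+n≤o⇒m≤o (suc b) i+n≤m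
  b≤m : b ≤ m
  b≤m = ℕ.<⇒≤ i≤m
  1+n≤m-b : suc n ≤ m ∸ b
  1+n≤m-b = ℕ.m+n≤o⇒m≤o∸n (suc n) (subst (_≤ m) (cong suc (ℕ.+-comm b n)) i+n≤m)
  R : ℚ
  R = sumInv x m ℚ.- sumInv x b
  R≥1⇒xᵢ≡1 : ℚ.1ℚ ℚ.≤ R → x (suc b) ≡ 1
  R≥1⇒xᵢ≡1 = proj₁ (proj₂ (greedy (suc b) (s≤s z≤n) i≤m))
  R<1⇒bounds : R < ℚ.1ℚ → inv (x (suc b)) ℚ.≤ R × R < inv (x (suc b) ∸ 2)
  R<1⇒bounds = proj₂ (proj₂ (greedy (suc b) (s≤s z≤n) i≤m))
  R<1 : R < ℚ.1ℚ
  R<1 with R ℚ.<? ℚ.1ℚ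
  ... | yes R<1 = R<1
  ... | no  R≮1 = contradiction (R≥1⇒xᵢ≡1 (ℚ.≮⇒≥ R≮1)) xᵢ≢1

coef : ℕ → ℤ
coef a = + a ℤ.* (+ a ℤ.- + 2)

module Window (x : ℕ → ℕ) (i r : ℕ) where

  zs : List ℤ
  zs = slice x (suc i) r

  A P E Z : ℤ
  A = coef (x i)
  P = prodℤ zs
  E = σpred r zs
  Z = + x (suc (i ℕ.+ r))

  expr-as-ratio : expr x i (suc (suc (i ℕ.+ r))) ≡ ratio A P E Z
  expr-as-ratio = begin
      expr x i (suc (suc (i ℕ.+ r)))   ≡⟨ cong exprOfLength k∸i≡2+r ⟩
      exprOfLength (suc (suc r))        ≡⟨ cong₂ frac numerator denominator ⟩
      ratio A P E Z                     ∎
    where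
    open ≡-Reasoning
    a : ℤ
    a = + x i
    exprOfLength : ℕ → ℚ
    exprOfLength n = frac ((a ℤ.- + 2) ℤ.* prodℤ (slice x i n))
      (+ 2 ℤ.* σ (n ∸ 1) (slice x i n) ℤ.- (a ℤ.* a) ℤ.* σ (n ∸ 2) (slice x (suc i) (n ∸ 1)))
    k∸i≡2+r : suc (suc (i ℕ.+ r)) ∸ i ≡ suc (suc r)
    k∸i≡2+r = trans (ℕ.+-∸-assoc 2 (ℕ.m≤m+n i r)) (cong (2 ℕ.+_) (ℕ.m+n∸m≡n i r))
    numerator-identity : ∀ a P Z → (a ℤ.- + 2) ℤ.* (a ℤ.* (P ℤ.* Z)) ≡ a ℤ.* (a ℤ.- + 2) ℤ.* (P ℤ.* Z)
    numerator-identity = solve-∀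
    numerator : (a ℤ.- + 2) ℤ.* prodℤ (a ∷ slice x (suc i) (suc r)) ≡ A ℤ.* (P ℤ.* Z)
    numerator = trans (cong (λ w → (a ℤ.- + 2) ℤ.* (a ℤ.* w)) (prodℤ-slice-suc x (suc i) r))
                      (numerator-identity a P Z)
    denominator-identity : ∀ a P E Z →
      + 2 ℤ.* (a ℤ.* (P ℤ.+ Z ℤ.* E) ℤ.+ Z ℤ.* P) ℤ.- (a ℤ.* a) ℤ.* (P ℤ.+ Z ℤ.* E)
        ≡ + 2 ℤ.* (P ℤ.* Z) ℤ.- a ℤ.* (a ℤ.- + 2) ℤ.* (P ℤ.+ Z ℤ.* E)
    denominator-identity = solve-∀
    denominator : + 2 ℤ.* σ (suc r) (a ∷ slice x (suc i) (suc r))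
                    ℤ.- (a ℤ.* a) ℤ.* σ r (slice x (suc i) (suc r)) ≡ den A P E Z
    denominator = trans (cong₂ (λ s t → + 2 ℤ.* (a ℤ.* s ℤ.+ t) ℤ.- (a ℤ.* a) ℤ.* s)
                               (σ-slice-suc x (suc i) r) (σ-suc-slice-suc x (suc i) r))
                        (denominator-identity a P E Z)

  module _ {m} (greedy : IsOddGreedy x m) (1≤i : 1 ≤ i) (k≤m : suc (suc (i ℕ.+ r)) ≤ m) where

    private
      i+r<m : i ℕ.+ r ℕ.< m
      i+r<m = ℕ.<⇒≤ k≤m

      slice-positive : ∀ n → n ≤ suc r → All (0ℤ ℤ.<_) (slice x (suc i) n)
      slice-positive n n≤1+r = All-slice x (suc i) n λ j i<j j<i+1+n →
        +<+ (odd-positive (proj₁ (greedy j (ℕ.≤-trans (s≤s z≤n) i<j) (j≤m j<i+1+n))))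
        where
        j≤m : ∀ {j} → j ℕ.< suc i ℕ.+ n → j ≤ m
        j≤m j<i+1+n = ℕ.≤-trans (ℕ.<⇒≤ j<i+1+n) (ℕ.≤-trans (ℕ.+-monoʳ-≤ (suc i) n≤1+r)
          (ℕ.≤-trans (ℕ.≤-reflexive (cong suc (ℕ.+-suc i r))) k≤m))

      0<P : 0ℤ ℤ.< P
      0<P = prodℤ-pos (slice-positive r (ℕ.n≤1+n r))

      0≤E : 0ℤ ℤ.≤ E
      0≤E = σpred-nonNeg r (All-slice x (suc i) r λ _ _ _ → +≤+ z≤n)

    conditions-from-gap : ∀ c → x i ≡ suc (suc (suc c)) →
      RatioConditions (coef (suc (suc (suc c)))) P E Z
    conditions-from-gap c xᵢ≡3+c =
      (λ ()) , 0<P , 0<den , slope-pos {A′} {P} {E} {Z} (+≤+ z≤n) (ℤ.<⇒≤ 0<P) (+≤+ z≤n) 0<den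
      where
      A′ : ℤ
      A′ = coef (suc (suc (suc c)))
      ws : List ℤ
      ws = slice x (suc i) (suc r)
      gap : invᵘ (suc (suc (suc c))) ℚᵘ.+ sumInvᵘ ws ℚᵘ.< invᵘ (suc c)
      gap = subst (λ a → invᵘ a ℚᵘ.+ sumInvᵘ ws ℚᵘ.< invᵘ (a ∸ 2)) xᵢ≡3+c
                  (odd-greedy-gap (suc r) greedy 1≤i (subst (_≤ m) (sym (ℕ.+-suc i r)) i+r<m)
                                  (λ xᵢ≡1 → contradiction (trans (sym xᵢ≡3+c) xᵢ≡1) λ ()))
      prod-sum : prodℤ ws / 1 ℚᵘ.* sumInvᵘ ws ≃ σ r ws / 1
      prod-sum = subst (λ n → prodℤ ws / 1 ℚᵘ.* sumInvᵘ ws ≃ σpred n ws / 1)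
                       (length-slice x (suc i) (suc r)) (prodℤ-*-sumInvᵘ (slice-positive (suc r) ℕ.≤-refl))
      two : + suc (suc (suc c)) ℤ.- + suc c ≡ + 2
      two = trans (cong (ℤ._- + suc c) (ℤ.pos-+ 2 (suc c))) (identity (+ suc c))
        where
        identity : ∀ b → + 2 ℤ.+ b ℤ.- b ≡ + 2
        identity = solve-∀
      0<den : 0ℤ ℤ.< den A′ P E Z
      0<den = i<j⇒0<j-i (subst₂ ℤ._<_ (cong (A′ ℤ.*_) (σ-slice-suc x (suc i) r))
                                        (cong₂ ℤ._*_ two (prodℤ-slice-suc x (suc i) r))
                                        (reciprocal-gap (suc (suc c)) c {sumInvᵘ ws}
                                          (prodℤ-pos (slice-positive (suc r) ℕ.≤-refl)) prod-sum gap))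

    ratio-conditions : RatioConditions A P E Z
    ratio-conditions with odd-cases (proj₁ (greedy i 1≤i (ℕ.≤-trans (ℕ.m≤m+n i r) (ℕ.<⇒≤ i+r<m))))
    ... | inj₁ xᵢ≡1 =
      subst (λ a → RatioConditions (coef a) P E Z) (sym xᵢ≡1) (conditions-at-−1 0<P 0≤E (+≤+ z≤n))
    ... | inj₂ (c , xᵢ≡3+c) =
      subst (λ a → RatioConditions (coef a) P E Z) (sym xᵢ≡3+c) (conditions-from-gap c xᵢ≡3+c)

bump-≡ : ∀ x p d → bump x p d p ≡ x p ℕ.+ d
bump-≡ x p d with p ℕ.≡ᵇ p | ℕ.≡⇒≡ᵇ p p refl
... | true  | _  = refl
... | false | ()

bump-≢ : ∀ x p d {j} → j ≢ p → bump x p d j ≡ x j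
bump-≢ x p d {j} j≢p with j ℕ.≡ᵇ p in j≡ᵇp
... | false = refl
... | true  = contradiction (ℕ.≡ᵇ⇒≡ j p (subst T (sym j≡ᵇp) tt)) j≢p

slice-bump : ∀ x p d a n → a ℕ.+ n ≤ p → slice (bump x p d) a n ≡ slice x a n
slice-bump x p d a zero    _        = refl
slice-bump x p d a (suc n) a+1+n≤p =
  cong₂ _∷_ (cong +_ (bump-≢ x p d (ℕ.<⇒≢ a<p)))
            (slice-bump x p d (suc a) n (subst (_≤ p) (ℕ.+-suc a n) a+1+n≤p))
  where
  a<p : a ℕ.< p
  a<p = ℕ.<-≤-trans (ℕ.m<m+n a (s≤s z≤n)) a+1+n≤p

expr-bump-as-ratio : ∀ x i r d →
  expr (bump x (suc (i ℕ.+ r)) d) i (suc (suc (i ℕ.+ r)))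
    ≡ ratio (Window.A x i r) (Window.P x i r) (Window.E x i r) (Window.Z x i r ℤ.+ + d)
expr-bump-as-ratio x i r d = begin
    expr y i (suc (suc (i ℕ.+ r)))     ≡⟨ Window.expr-as-ratio y i r ⟩
    ratio-of (y i) (slice y (suc i) r) (+ y p)
      ≡⟨ cong₂ (λ a zs → ratio-of a zs (+ y p))
               (bump-≢ x p d i≢p) (slice-bump x p d (suc i) r ℕ.≤-refl) ⟩
    ratio-of (x i) (slice x (suc i) r) (+ y p)
      ≡⟨ cong (ratio-of (x i) (slice x (suc i) r))
              (trans (cong +_ (bump-≡ x p d)) (ℤ.pos-+ (x p) d)) ⟩
    ratio-of (x i) (slice x (suc i) r) (+ x p ℤ.+ + d) ∎
  where
  open ≡-Reasoning
  p : ℕ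
  p = suc (i ℕ.+ r)
  y : ℕ → ℕ
  y = bump x p d
  ratio-of : ℕ → List ℤ → ℤ → ℚ
  ratio-of a zs z = ratio (coef a) (prodℤ zs) (σpred r zs) z
  i≢p : i ≢ p
  i≢p = ℕ.<⇒≢ (s≤s (ℕ.m≤m+n i r))

lemma5p1 : (i k m t : ℕ) → 1 ≤ i → 1 ≤ k → 1 ≤ m → 1 ≤ t →
           i ≤ k ∸ 2 → k ≤ m →
           (x : ℕ → ℕ) → IsOddGreedy x m →
           expr (bump x (k ∸ 1) (2 * t)) i k < expr x i k
lemma5p1 i zero          m t 1≤i _ _ _ i≤0 _ _ _ = contradiction (ℕ.≤-trans 1≤i i≤0) λ ()
lemma5p1 i (suc zero)    m t 1≤i _ _ _ i≤0 _ _ _ = contradiction (ℕ.≤-trans 1≤i i≤0) λ ()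
lemma5p1 i (suc (suc k)) m t 1≤i _ _ 1≤t i≤k k+2≤m x greedy with ℕ.m≤n⇒∃[o]m+o≡n i≤k
... | r , refl = begin-strict
    expr (bump x (suc (i ℕ.+ r)) (2 * t)) i (suc (suc (i ℕ.+ r)))
      ≡⟨ expr-bump-as-ratio x i r (2 * t) ⟩
    ratio A P E (Z ℤ.+ + (2 * t))
      <⟨ ratio-decreasing (ratio-conditions greedy 1≤i k+2≤m) 0<2t ⟩
    ratio A P E Z
      ≡⟨ expr-as-ratio ⟨
    expr x i (suc (suc (i ℕ.+ r))) ∎
  where
  open Window x i r
  open ℚ.≤-Reasoning
  0<2t : 0ℤ ℤ.< + (2 * t)
  0<2t = +<+ (ℕ.≤-trans (s≤s z≤n) (ℕ.*-monoʳ-≤ 2 1≤t))
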